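{- In System $\mathsf{F}_\wedge$, if $\Theta\vdash S'<:S$ and $\Theta,X<:\top\vdash T<:T'$, then $\Theta\vdash\forall X.T[X\wedge S/X^-]<:\forall X.T'[X\wedge S'/X^-]$.
   Context: System $\mathsf{F}_\wedge$. Types: $T ::= \top\mid X\mid T\to T\mid\forall X.T\mid T\wedge T$ (up to $\alpha$-conversion). Contexts are finite sequences of assumptions $X<:T$ and $x:T$ with the usual well-formedness judgment. Subtyping $\Theta\vdash S<:T$ is generated by: (Var) $\Theta,X<:T,\Theta'\vdash X<:T$; (Top) $\Theta\vdash T<:\top$; (Refl); (Trans); ($\to$) from $\Theta\vdash S'<:S$, $\Theta\vdash T<:T'$ infer $\Theta\vdash S\to T<:S'\to T'$; ($\forall$) from $\Theta,X<:\top\vdash S<:T$ infer $\Theta\vdash\forall X.S<:\forall X.T$; $S\wedge S'<:S$; $S\wedge S'<:S'$; $T<:S\wedge S'$ from $T<:S$ and $T<:S'$. Mixed substitution $T[(S_-,S_+)/X]$ (bound variables renamed to avoid capture): $X[(S_-,S_+)/X]=S_+$; $Y[(S_-,S_+)/X]=Y$ for $Y\not\equiv X$; $\top[(S_-,S_+)/X]=\top$; $(T\to T')[(S_-,S_+)/X]=T[(S_+,S_-)/X]\to T'[(S_-,S_+)/X]$; $(\forall Y.T)[(S_-,S_+)/X]=\forall Y.T[(S_-,S_+)/X]$; $(T\wedge T')[(S_-,S_+)/X]=T[(S_-,S_+)/X]\wedge T'[(S_-,S_+)/X]$. $T[R/X^-]$ abbreviates $T[(R,X)/X]$ (substitute $R$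 for the negative occurrences of $X$ only). -}

module Defs where

open import Data.Nat using (ℕ; zero; suc)
open import Data.Fin using (Fin; zero; suc)

-- Types of System F∧, well-scoped de Bruijn representation
-- (α-conversion is built in; Ty n = types with n free type variables).
infixr 7 _⇒_
infixl 8 _∧_
data Ty (n : ℕ) : Set where
  ⊤'   : Ty n
  var  : Fin n → Ty n
  _⇒_  : Ty n → Ty n → Ty n
  ∀'   : Ty (suc n) → Ty n
  _∧_  : Ty n → Ty n → Ty n

ext : ∀ {m k} → (Fin m → Fin k) → Fin (suc m) → Fin (suc k)
ext ρ zero    = zero
ext ρ (suc i) = suc (ρ i)

ren : ∀ {m k} → (Fin m → Fin k) → Ty m → Ty k
ren ρ ⊤'       = ⊤'
ren ρ (var i)  = var (ρ i)
ren ρ (A ⇒ B)  = ren ρ A ⇒ ren ρ B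
ren ρ (∀' A)   = ∀' (ren (ext ρ) A)
ren ρ (A ∧ B)  = ren ρ A ∧ ren ρ B

wk : ∀ {n} → Ty n → Ty (suc n)
wk = ren suc

exts : ∀ {m k} → (Fin m → Ty k) → Fin (suc m) → Ty (suc k)
exts σ zero    = var zero
exts σ (suc i) = wk (σ i)

-- Parallel mixed substitution: σ⁻ is used at negative occurrences,
-- σ⁺ at positive ones; the two are swapped on the left of an arrow.
msub : ∀ {m k} → (Fin m → Ty k) → (Fin m → Ty k) → Ty m → Ty k
msub σ⁻ σ⁺ ⊤'       = ⊤'
msub σ⁻ σ⁺ (var i)  = σ⁺ i
msub σ⁻ σ⁺ (A ⇒ B)  = msub σ⁺ σ⁻ A ⇒ msub σ⁻ σ⁺ B
msub σ⁻ σ⁺ (∀' A)   = ∀' (msub (exts σ⁻) (exts σ⁺) A)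
msub σ⁻ σ⁺ (A ∧ B)  = msub σ⁻ σ⁺ A ∧ msub σ⁻ σ⁺ B

single : ∀ {n} → Ty (suc n) → Fin (suc n) → Ty (suc n)
single R zero    = R
single R (suc i) = var (suc i)

-- T[(S₋,S₊)/X] where X is the variable bound most recently (var zero)
_[_,_/X] : ∀ {n} → Ty (suc n) → Ty (suc n) → Ty (suc n) → Ty (suc n)
T [ S₋ , S₊ /X] = msub (single S₋) (single S₊) T

_[_/X⁻] : ∀ {n} → Ty (suc n) → Ty (suc n) → Ty (suc n)
T [ R /X⁻] = T [ R , var zero /X]

infixl 5 _,<:_ _,∶_
data Ctx : ℕ → Set where
  ε     : Ctx zero
  _,<:_ : ∀ {n} → Ctx n → Ty n → Ctx (suc n)
  _,∶_  : ∀ {n} → Ctx n → Ty n → Ctx n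

-- Θ ∋ X <: T : the context contains X<:T (bound weakened to the whole context)
data _∋_<:_ : ∀ {n} → Ctx n → Fin n → Ty n → Set where
  here  : ∀ {n} {Θ : Ctx n} {T} → (Θ ,<: T) ∋ zero <: wk T
  there : ∀ {n} {Θ : Ctx n} {i T U} → Θ ∋ i <: T → (Θ ,<: U) ∋ suc i <: wk T
  skip  : ∀ {n} {Θ : Ctx n} {i T U} → Θ ∋ i <: T → (Θ ,∶ U) ∋ i <: T

infix 4 _⊢_<:_
data _⊢_<:_ {n : ℕ} (Θ : Ctx n) : Ty n → Ty n → Set where
  <:-var   : ∀ {i T} → Θ ∋ i <: T → Θ ⊢ var i <: T
  <:-top   : ∀ {T} → Θ ⊢ T <: ⊤'
  <:-refl  : ∀ {T} → Θ ⊢ T <: T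
  <:-trans : ∀ {S T U} → Θ ⊢ S <: T → Θ ⊢ T <: U → Θ ⊢ S <: U
  <:-arr   : ∀ {S S' T T'} → Θ ⊢ S' <: S → Θ ⊢ T <: T' → Θ ⊢ S ⇒ T <: S' ⇒ T'
  <:-all   : ∀ {S T} → (Θ ,<: ⊤') ⊢ S <: T → Θ ⊢ ∀' S <: ∀' T
  <:-∧l    : ∀ {S S'} → Θ ⊢ S ∧ S' <: S
  <:-∧r    : ∀ {S S'} → Θ ⊢ S ∧ S' <: S'
  <:-∧     : ∀ {T S S'} → Θ ⊢ T <: S → Θ ⊢ T <: S' → Θ ⊢ T <: S ∧ S'

module Submission where

-- The theorem splits along transitivity through ∀X.T[X∧S'/X⁻]. First,
-- T[X∧S/X⁻] <: T[X∧S'/X⁻] because mixed substitution is monotone in its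
-- positive argument and antitone in its negative one, and X∧S' <: X∧S.
-- Second, T <: T' is preserved by the fixed mixed substitution (X∧S', X):
-- by induction on the derivation; the arrow rule swaps the two components,
-- so the claim is proved for any pair respecting the variable bounds in both
-- orders, which holds here because only X, bounded by ⊤, is moved.

open import Data.Nat using (ℕ; suc)
open import Data.Fin using (Fin; zero; suc)
open import Function using (_∘_)
open import Relation.Binary.PropositionalEquality
  using (_≡_; _≗_; refl; cong; cong₂; sym; trans; subst)
open import Defs

Sub : ℕ → ℕ → Set
Sub m k = Fin m → Ty k

ren-ren : ∀ {a b c} {ρ : Fin b → Fin c} {ρ' : Fin a → Fin b} {ρ'' : Fin a → Fin c}
  → ρ ∘ ρ' ≗ ρ'' → ∀ T → ren ρ (ren ρ' T) ≡ ren ρ'' T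
ren-ren h ⊤'      = refl
ren-ren h (var i) = cong var (h i)
ren-ren h (A ⇒ B) = cong₂ _⇒_ (ren-ren h A) (ren-ren h B)
ren-ren {ρ = ρ} {ρ'} {ρ''} h (∀' A) = cong ∀' (ren-ren ext-h A)
  where
  ext-h : ext ρ ∘ ext ρ' ≗ ext ρ''
  ext-h zero    = refl
  ext-h (suc i) = cong suc (h i)
ren-ren h (A ∧ B) = cong₂ _∧_ (ren-ren h A) (ren-ren h B)

ren-ext-wk : ∀ {m k} (ρ : Fin m → Fin k) T → ren (ext ρ) (wk T) ≡ wk (ren ρ T)
ren-ext-wk ρ T = trans (ren-ren (λ _ → refl) T) (sym (ren-ren (λ _ → refl) T))

msub-ren : ∀ {a b c} {σ⁻ σ⁺ : Sub b c} {τ⁻ τ⁺ : Sub a c} {ρ : Fin a → Fin b}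
  → σ⁻ ∘ ρ ≗ τ⁻ → σ⁺ ∘ ρ ≗ τ⁺ → ∀ T → msub σ⁻ σ⁺ (ren ρ T) ≡ msub τ⁻ τ⁺ T
msub-ren h⁻ h⁺ ⊤'      = refl
msub-ren h⁻ h⁺ (var i) = h⁺ i
msub-ren h⁻ h⁺ (A ⇒ B) = cong₂ _⇒_ (msub-ren h⁺ h⁻ A) (msub-ren h⁻ h⁺ B)
msub-ren {ρ = ρ} h⁻ h⁺ (∀' A) = cong ∀' (msub-ren (exts-h h⁻) (exts-h h⁺) A)
  where
  exts-h : ∀ {σ τ} → σ ∘ ρ ≗ τ → exts σ ∘ ext ρ ≗ exts τ
  exts-h h zero    = refl
  exts-h h (suc i) = cong wk (h i)
msub-ren h⁻ h⁺ (A ∧ B) = cong₂ _∧_ (msub-ren h⁻ h⁺ A) (msub-ren h⁻ h⁺ B)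

ren-msub : ∀ {a b c} {σ⁻ σ⁺ : Sub a b} {τ⁻ τ⁺ : Sub a c} {ρ : Fin b → Fin c}
  → ren ρ ∘ σ⁻ ≗ τ⁻ → ren ρ ∘ σ⁺ ≗ τ⁺ → ∀ T → ren ρ (msub σ⁻ σ⁺ T) ≡ msub τ⁻ τ⁺ T
ren-msub h⁻ h⁺ ⊤'      = refl
ren-msub h⁻ h⁺ (var i) = h⁺ i
ren-msub h⁻ h⁺ (A ⇒ B) = cong₂ _⇒_ (ren-msub h⁺ h⁻ A) (ren-msub h⁻ h⁺ B)
ren-msub {ρ = ρ} h⁻ h⁺ (∀' A) = cong ∀' (ren-msub (exts-h h⁻) (exts-h h⁺) A)
  where
  exts-h : ∀ {σ τ} → ren ρ ∘ σ ≗ τ → ren (ext ρ) ∘ exts σ ≗ exts τ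
  exts-h h zero        = refl
  exts-h {σ} h (suc i) = trans (ren-ext-wk ρ (σ i)) (cong wk (h i))
ren-msub h⁻ h⁺ (A ∧ B) = cong₂ _∧_ (ren-msub h⁻ h⁺ A) (ren-msub h⁻ h⁺ B)

msub-var : ∀ {a b} {σ⁻ σ⁺ : Sub a b} {ρ : Fin a → Fin b}
  → σ⁻ ≗ var ∘ ρ → σ⁺ ≗ var ∘ ρ → ∀ T → msub σ⁻ σ⁺ T ≡ ren ρ T
msub-var h⁻ h⁺ ⊤'      = refl
msub-var h⁻ h⁺ (var i) = h⁺ i
msub-var h⁻ h⁺ (A ⇒ B) = cong₂ _⇒_ (msub-var h⁺ h⁻ A) (msub-var h⁻ h⁺ B)
msub-var {ρ = ρ} h⁻ h⁺ (∀' A) = cong ∀' (msub-var (exts-h h⁻) (exts-h h⁺) A)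
  where
  exts-h : ∀ {σ} → σ ≗ var ∘ ρ → exts σ ≗ var ∘ ext ρ
  exts-h h zero    = refl
  exts-h h (suc i) = cong wk (h i)
msub-var h⁻ h⁺ (A ∧ B) = cong₂ _∧_ (msub-var h⁻ h⁺ A) (msub-var h⁻ h⁺ B)

msub-exts-wk : ∀ {m k} (σ⁻ σ⁺ : Sub m k) T
  → msub (exts σ⁻) (exts σ⁺) (wk T) ≡ wk (msub σ⁻ σ⁺ T)
msub-exts-wk σ⁻ σ⁺ T =
  trans (msub-ren {τ⁻ = wk ∘ σ⁻} {τ⁺ = wk ∘ σ⁺} (λ _ → refl) (λ _ → refl) T)
        (sym (ren-msub (λ _ → refl) (λ _ → refl) T))

msub-single-wk : ∀ {n} (R R' : Ty (suc n)) (T : Ty n)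
  → msub (single R) (single R') (wk T) ≡ wk T
msub-single-wk R R' T =
  trans (msub-ren (λ _ → refl) (λ _ → refl) T) (msub-var (λ _ → refl) (λ _ → refl) T)

<:-ren : ∀ {m k} {Γ : Ctx m} {Δ : Ctx k} (ρ : Fin m → Fin k)
  → (∀ {i B} → Γ ∋ i <: B → Δ ∋ ρ i <: ren ρ B)
  → ∀ {A B} → Γ ⊢ A <: B → Δ ⊢ ren ρ A <: ren ρ B
<:-ren ρ h (<:-var x)     = <:-var (h x)
<:-ren ρ h <:-top         = <:-top
<:-ren ρ h <:-refl        = <:-refl
<:-ren ρ h (<:-trans d e) = <:-trans (<:-ren ρ h d) (<:-ren ρ h e)
<:-ren ρ h (<:-arr d e)   = <:-arr (<:-ren ρ h d) (<:-ren ρ h e)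
<:-ren {Γ = Γ} {Δ} ρ h (<:-all d) = <:-all (<:-ren (ext ρ) ext-h d)
  where
  ext-h : ∀ {i B} → (Γ ,<: ⊤') ∋ i <: B → (Δ ,<: ⊤') ∋ ext ρ i <: ren (ext ρ) B
  ext-h here              = here
  ext-h (there {T = T} x) =
    subst ((Δ ,<: ⊤') ∋ _ <:_) (sym (ren-ext-wk ρ T)) (there (h x))
<:-ren ρ h <:-∧l          = <:-∧l
<:-ren ρ h <:-∧r          = <:-∧r
<:-ren ρ h (<:-∧ d e)     = <:-∧ (<:-ren ρ h d) (<:-ren ρ h e)

<:-weaken : ∀ {m} {Δ : Ctx m} {U A B} → Δ ⊢ A <: B → (Δ ,<: U) ⊢ wk A <: wk B
<:-weaken = <:-ren suc there

∧-mono : ∀ {m} {Δ : Ctx m} {A A' B B'}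
  → Δ ⊢ A <: A' → Δ ⊢ B <: B' → Δ ⊢ A ∧ B <: A' ∧ B'
∧-mono d e = <:-∧ (<:-trans <:-∧l d) (<:-trans <:-∧r e)

_⊢ˢ_<:_ : ∀ {m k} → Ctx k → Sub m k → Sub m k → Set
Δ ⊢ˢ σ <: τ = ∀ i → Δ ⊢ σ i <: τ i

exts-mono : ∀ {m k} {Δ : Ctx k} {σ τ : Sub m k}
  → Δ ⊢ˢ σ <: τ → (Δ ,<: ⊤') ⊢ˢ exts σ <: exts τ
exts-mono h zero    = <:-refl
exts-mono h (suc i) = <:-weaken (h i)

msub-mono : ∀ {m k} {Δ : Ctx k} {σ⁻ σ⁺ τ⁻ τ⁺ : Sub m k}
  → Δ ⊢ˢ τ⁻ <: σ⁻ → Δ ⊢ˢ σ⁺ <: τ⁺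
  → ∀ T → Δ ⊢ msub σ⁻ σ⁺ T <: msub τ⁻ τ⁺ T
msub-mono h⁻ h⁺ ⊤'      = <:-top
msub-mono h⁻ h⁺ (var i) = h⁺ i
msub-mono h⁻ h⁺ (A ⇒ B) = <:-arr (msub-mono h⁺ h⁻ A) (msub-mono h⁻ h⁺ B)
msub-mono h⁻ h⁺ (∀' A)  = <:-all (msub-mono (exts-mono h⁻) (exts-mono h⁺) A)
msub-mono h⁻ h⁺ (A ∧ B) = ∧-mono (msub-mono h⁻ h⁺ A) (msub-mono h⁻ h⁺ B)

RespectsBounds : ∀ {m k} → Ctx m → Ctx k → Sub m k → Sub m k → Set
RespectsBounds Γ Δ σ⁻ σ⁺ = ∀ {i B} → Γ ∋ i <: B → Δ ⊢ σ⁺ i <: msub σ⁻ σ⁺ B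

exts-respectsBounds : ∀ {m k} {Γ : Ctx m} {Δ : Ctx k} {σ⁻ σ⁺ : Sub m k}
  → RespectsBounds Γ Δ σ⁻ σ⁺
  → RespectsBounds (Γ ,<: ⊤') (Δ ,<: ⊤') (exts σ⁻) (exts σ⁺)
exts-respectsBounds h here = <:-top
exts-respectsBounds {σ⁻ = σ⁻} {σ⁺} h (there {T = T} x) =
  subst (_ ⊢ _ <:_) (sym (msub-exts-wk σ⁻ σ⁺ T)) (<:-weaken (h x))

single-respectsBounds : ∀ {n} {Θ : Ctx n} (R R' : Ty (suc n))
  → RespectsBounds (Θ ,<: ⊤') (Θ ,<: ⊤') (single R) (single R')
single-respectsBounds R R' here = <:-top
single-respectsBounds R R' (there {T = T} x) =
  subst (_ ⊢ _ <:_) (sym (msub-single-wk R R' T)) (<:-var (there x))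

msub-<: : ∀ {m k} {Γ : Ctx m} {Δ : Ctx k} {σ⁻ σ⁺ : Sub m k}
  → RespectsBounds Γ Δ σ⁻ σ⁺ → RespectsBounds Γ Δ σ⁺ σ⁻
  → ∀ {T T'} → Γ ⊢ T <: T' → Δ ⊢ msub σ⁻ σ⁺ T <: msub σ⁻ σ⁺ T'
msub-<: h⁻⁺ h⁺⁻ (<:-var x)     = h⁻⁺ x
msub-<: h⁻⁺ h⁺⁻ <:-top         = <:-top
msub-<: h⁻⁺ h⁺⁻ <:-refl        = <:-refl
msub-<: h⁻⁺ h⁺⁻ (<:-trans d e) = <:-trans (msub-<: h⁻⁺ h⁺⁻ d) (msub-<: h⁻⁺ h⁺⁻ e)
msub-<: h⁻⁺ h⁺⁻ (<:-arr d e)   = <:-arr (msub-<: h⁺⁻ h⁻⁺ d) (msub-<: h⁻⁺ h⁺⁻ e)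
msub-<: h⁻⁺ h⁺⁻ (<:-all d)     =
  <:-all (msub-<: (exts-respectsBounds h⁻⁺) (exts-respectsBounds h⁺⁻) d)
msub-<: h⁻⁺ h⁺⁻ <:-∧l          = <:-∧l
msub-<: h⁻⁺ h⁺⁻ <:-∧r          = <:-∧r
msub-<: h⁻⁺ h⁺⁻ (<:-∧ d e)     = <:-∧ (msub-<: h⁻⁺ h⁺⁻ d) (msub-<: h⁻⁺ h⁺⁻ e)

mainTheorem18 : ∀ {n} (Θ : Ctx n) (S S' : Ty n) (T T' : Ty (suc n))
    → Θ ⊢ S' <: S
    → (Θ ,<: ⊤') ⊢ T <: T'
    → Θ ⊢ ∀' (T [ var zero ∧ wk S /X⁻]) <: ∀' (T' [ var zero ∧ wk S' /X⁻])
mainTheorem18 Θ S S' T T' S'<:S T<:T' =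
  <:-all (<:-trans (msub-mono bound⁻ (λ _ → <:-refl) T)
                   (msub-<: (single-respectsBounds R' X) (single-respectsBounds X R') T<:T'))
  where
  X R' : Ty _
  X  = var zero
  R' = X ∧ wk S'

  bound⁻ : (Θ ,<: ⊤') ⊢ˢ single R' <: single (X ∧ wk S)
  bound⁻ zero    = ∧-mono <:-refl (<:-weaken S'<:S)
  bound⁻ (suc i) = <:-refl
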